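{- Let $p$ be a prime number, let $G\simeq C_2\oplus C_{2p}$, and let $f$ be an automorphism of $\mathcal{P}_{0}(G)$ with trivial pullback. Then $f$ is the identity.
   Context: For an additively written finite abelian group $G$, $\mathcal{P}_{0}(G)$ denotes the reduced power monoid of $G$: the set of all subsets of $G$ containing $0$, with setwise addition $X+Y=\{x+y : x\in X, y\in Y\}$ and identity $\{0\}$. An automorphism $f$ of $\mathcal{P}_{0}(G)$ has trivial pullback if $f(\{0,a\})=\{0,a\}$ for every $a\in G$. $C_k$ is the cyclic group of order $k$. -}

module Defs where

open import Data.Bool using (Bool; true; false; _∧_; _∨_; T)
open import Data.Nat using (ℕ; suc; _+_)
open import Data.Nat.DivMod using (_mod_)
open import Data.Fin using (Fin; zero; toℕ; _≟_)
open import Data.List using (List; allFin; concatMap; map)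
open import Data.Bool.ListAction using (any)
open import Data.Vec using (Vec; lookup; tabulate)
open import Data.Product using (Σ; _×_; _,_; proj₁)
open import Relation.Nullary.Decidable using (⌊_⌋)
open import Relation.Binary.PropositionalEquality using (_≡_)
open import Data.Unit using (tt)

_+ₘ_ : ∀ {k} → Fin (suc k) → Fin (suc k) → Fin (suc k)
_+ₘ_ {k} a b = (toℕ a + toℕ b) mod (suc k)

G : ℕ → Set
G n = Fin 2 × Fin (suc n)

0G : ∀ {n} → G n
0G = zero , zero

_+G_ : ∀ {n} → G n → G n → G n
(a , b) +G (c , d) = (a +ₘ c) , (b +ₘ d)

_==G_ : ∀ {n} → G n → G n → Bool
(a , b) ==G (c , d) = ⌊ a ≟ c ⌋ ∧ ⌊ b ≟ d ⌋

elems : ∀ n → List (G n)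
elems n = concatMap (λ i → map (λ j → (i , j)) (allFin (suc n))) (allFin 2)

Subset : ℕ → Set
Subset n = Vec (Vec Bool (suc n)) 2

_∈ᵇ_ : ∀ {n} → G n → Subset n → Bool
(i , j) ∈ᵇ X = lookup (lookup X i) j

_⊕_ : ∀ {n} → Subset n → Subset n → Subset n
_⊕_ {n} X Y = tabulate λ i → tabulate λ j →
  any (λ x → any (λ y → (x ∈ᵇ X) ∧ (y ∈ᵇ Y) ∧ ((x +G y) ==G (i , j))) (elems n)) (elems n)

pair0 : ∀ {n} → G n → Subset n
pair0 a = tabulate λ i → tabulate λ j → ((i , j) ==G 0G) ∨ ((i , j) ==G a)

single0 : ∀ {n} → Subset n
single0 = tabulate λ i → tabulate λ j → (i , j) ==G 0G

P₀ : ℕ → Set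
P₀ n = Σ (Subset n) (λ X → T (0G ∈ᵇ X))

ε₀ : ∀ {n} → P₀ n
ε₀ = single0 , tt

pair0ᴾ : ∀ {n} → G n → P₀ n
pair0ᴾ a = pair0 a , tt

-- Monoid automorphism of P₀(G): bijective, preserves setwise addition and the identity.
-- (Addition on P₀ is stated on underlying subsets: whenever Z = X + Y then f Z = f X + f Y.)
record IsAutomorphism {n : ℕ} (f : P₀ n → P₀ n) : Set where
  field
    injective  : ∀ X Y → f X ≡ f Y → X ≡ Y
    surjective : ∀ Y → Σ (P₀ n) (λ X → f X ≡ Y)
    hom        : ∀ X Y Z → proj₁ Z ≡ proj₁ X ⊕ proj₁ Y →
                 proj₁ (f Z) ≡ proj₁ (f X) ⊕ proj₁ (f Y)
    unit       : f ε₀ ≡ ε₀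

TrivialPullback : ∀ {n} → (P₀ n → P₀ n) → Set
TrivialPullback {n} f = ∀ (a : G n) → f (pair0ᴾ a) ≡ pair0ᴾ a

-- Write σ a X = X + {0, a}. Since f is a homomorphism fixing every {0, a}, it commutes with each
-- σ a, and it fixes the full group. We show f X = X by strong induction on the number of points
-- missing from X. If c is not a period of X, then σ c X misses fewer points and is fixed, so a
-- point x with x, x - c ∉ X is missing from σ c X = σ c (f X), hence from f X, and conversely.
-- When X misses x₀, y₀ such that x₀ - y₀ is not a period, every missing x is covered this way by
-- c = x - y₀ or c = x - x₀, so X and f X miss the same points. Otherwise the missing points lie
-- in one coset of the period group. If there are at least two of them, X = σ p (X ∖ {z}) for a
-- nonzero period p and a suitable z ∈ X, and X ∖ {z} falls under the first argument once its
-- shifts by non-periods are fixed; these miss at most two points, so they are fixed by induction,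
-- or by the first argument when X itself misses only two points. A single missing point c is
-- handled directly: if f (G ∖ {c}) misses c + t then f (G ∖ {d}) misses d + t whenever
-- 2 (c - d) ≠ 0 (compare both with G ∖ {c, d}), and an element of order > 2 lets us move c to -t
-- in at most two such steps, which forces t = 0.

module Submission where

open import Defs
open import Algebra.Bundles using (AbelianGroup)
import Algebra.Properties.AbelianGroup
import Algebra.Solver.CommutativeMonoid
open import Data.Bool using (Bool; true; false; _∧_; _∨_; not; T; if_then_else_)
import Data.Bool as Bool
open import Data.Bool.ListAction using (any)
open import Data.Bool.Properties using (T-∧; T-∨; T-≡; T-irrelevant)
open import Data.Fin using (Fin; toℕ; fromℕ<; combine; remQuot) renaming (zero to 0F)
import Data.Fin as Fin
open import Data.Fin.Properties
  using (toℕ-injective; toℕ-fromℕ<; toℕ<n; suc-injective; remQuot-combine; combine-remQuot; any?; all?)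
open import Data.List using ([]; _∷_; allFin; map; length)
open import Data.List.Membership.Propositional using (lose) renaming (_∈_ to _∈ˡ_)
open import Data.List.Membership.Propositional.Properties using (∈-allFin; ∈-map⁺; ∈-map⁻; ∈-concatMap⁺)
open import Data.List.Properties using (length-map)
open import Data.List.Relation.Unary.All as All using ([]; _∷_)
open import Data.List.Relation.Unary.AllPairs using ([]; _∷_)
open import Data.List.Relation.Unary.Any using (here; there; satisfied; tail)
open import Data.List.Relation.Unary.Any.Properties using (any⁺; any⁻)
open import Data.List.Relation.Unary.Unique.Propositional using (Unique)
import Data.List.Relation.Unary.Unique.Propositional.Properties as Unique
open import Data.Nat using (ℕ; zero; suc; _+_; _∸_; _*_; _%_; _≤_; _<_; z≤n; s≤s; NonZero; nonTrivial⇒n>1)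
open import Data.Nat.DivMod using (_mod_; %-distribˡ-+; m%n%n≡m%n; n%n≡0; m<n⇒m%n≡m; m*n%n≡0)
open import Data.Nat.Primality using (Prime; prime⇒nonTrivial)
open import Data.Nat.Properties
  using (+-comm; +-assoc; *-comm; *-assoc; *-monoʳ-≤; m+[n∸m]≡n; 0≢1+n; n≤1+n; <⇒≤; ≤-refl; ≤-reflexive;
         ≤-trans; <-≤-trans; ≤-antisym; ≤-pred; m≤n⇒m≤1+n)
open import Data.Product using (∃; ∃₂; _×_; _,_; proj₁; proj₂)
open import Data.Product.Properties using (≡-dec)
open import Data.Sum using (_⊎_; inj₁; inj₂; swap)
open import Data.Vec using (tabulate; lookup)
open import Data.Vec.Properties using (lookup∘tabulate; tabulate∘lookup; tabulate-cong)
open import Function using (_∘_; case_of_)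
open import Function.Bundles using (Equivalence)
open import Level using (0ℓ)
open import Relation.Binary.Definitions using (DecidableEquality)
open import Relation.Binary.PropositionalEquality
open import Relation.Binary.PropositionalEquality.Algebra using (isMagma)
open import Relation.Nullary using (Dec; yes; no; does; ¬_; contradiction)
open import Relation.Nullary.Decidable
  using (map′; toWitness; fromWitness; T?; dec-true; dec-false; decidable-stable; _×-dec_; ¬?)
open import Relation.Unary using (Pred; Decidable; _⊆_)
open ≡-Reasoning

-- Arithmetic modulo suc k

module _ (m : ℕ) .{{_ : NonZero m}} where

  [a%m+b]%m≡[a+b]%m : ∀ a b → (a % m + b) % m ≡ (a + b) % m
  [a%m+b]%m≡[a+b]%m a b = begin
    (a % m + b) % m          ≡⟨ %-distribˡ-+ (a % m) b m ⟩
    (a % m % m + b % m) % m  ≡⟨ cong (λ x → (x + b % m) % m) (m%n%n≡m%n a m) ⟩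
    (a % m + b % m) % m      ≡⟨ %-distribˡ-+ a b m ⟨
    (a + b) % m              ∎

  [a+b%m]%m≡[a+b]%m : ∀ a b → (a + b % m) % m ≡ (a + b) % m
  [a+b%m]%m≡[a+b]%m a b = begin
    (a + b % m) % m  ≡⟨ cong (_% m) (+-comm a (b % m)) ⟩
    (b % m + a) % m  ≡⟨ [a%m+b]%m≡[a+b]%m b a ⟩
    (b + a) % m      ≡⟨ cong (_% m) (+-comm b a) ⟩
    (a + b) % m      ∎

module _ {k : ℕ} where

  -ₘ_ : Fin (suc k) → Fin (suc k)
  -ₘ a = (suc k ∸ toℕ a) mod suc k

  toℕ-+ₘ : ∀ (a b : Fin (suc k)) → toℕ (a +ₘ b) ≡ (toℕ a + toℕ b) % suc k
  toℕ-+ₘ a b = toℕ-fromℕ< _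

  +ₘ-comm : ∀ (a b : Fin (suc k)) → a +ₘ b ≡ b +ₘ a
  +ₘ-comm a b = cong (_mod suc k) (+-comm (toℕ a) (toℕ b))

  +ₘ-assoc : ∀ (a b c : Fin (suc k)) → (a +ₘ b) +ₘ c ≡ a +ₘ (b +ₘ c)
  +ₘ-assoc a b c = toℕ-injective (begin
    toℕ ((a +ₘ b) +ₘ c)                           ≡⟨ toℕ-+ₘ (a +ₘ b) c ⟩
    (toℕ (a +ₘ b) + toℕ c) % suc k                ≡⟨ cong (λ x → (x + toℕ c) % suc k) (toℕ-+ₘ a b) ⟩
    ((toℕ a + toℕ b) % suc k + toℕ c) % suc k     ≡⟨ [a%m+b]%m≡[a+b]%m (suc k) (toℕ a + toℕ b) (toℕ c) ⟩
    (toℕ a + toℕ b + toℕ c) % suc k               ≡⟨ cong (_% suc k) (+-assoc (toℕ a) (toℕ b) (toℕ c)) ⟩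
    (toℕ a + (toℕ b + toℕ c)) % suc k             ≡⟨ [a+b%m]%m≡[a+b]%m (suc k) (toℕ a) (toℕ b + toℕ c) ⟨
    (toℕ a + (toℕ b + toℕ c) % suc k) % suc k     ≡⟨ cong (λ x → (toℕ a + x) % suc k) (toℕ-+ₘ b c) ⟨
    (toℕ a + toℕ (b +ₘ c)) % suc k                ≡⟨ toℕ-+ₘ a (b +ₘ c) ⟨
    toℕ (a +ₘ (b +ₘ c))                           ∎)

  +ₘ-identityˡ : ∀ (a : Fin (suc k)) → 0F +ₘ a ≡ a
  +ₘ-identityˡ a = toℕ-injective (trans (toℕ-+ₘ 0F a) (m<n⇒m%n≡m (toℕ<n a)))

  +ₘ-inverseʳ : ∀ (a : Fin (suc k)) → a +ₘ (-ₘ a) ≡ 0F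
  +ₘ-inverseʳ a = toℕ-injective (begin
    toℕ (a +ₘ (-ₘ a))                            ≡⟨ toℕ-+ₘ a (-ₘ a) ⟩
    (toℕ a + toℕ (-ₘ a)) % suc k                 ≡⟨ cong (λ x → (toℕ a + x) % suc k) (toℕ-fromℕ< _) ⟩
    (toℕ a + (suc k ∸ toℕ a) % suc k) % suc k    ≡⟨ [a+b%m]%m≡[a+b]%m (suc k) (toℕ a) (suc k ∸ toℕ a) ⟩
    (toℕ a + (suc k ∸ toℕ a)) % suc k            ≡⟨ cong (_% suc k) (m+[n∸m]≡n (<⇒≤ (toℕ<n a))) ⟩
    suc k % suc k                                ≡⟨ n%n≡0 (suc k) ⟩
    0                                            ∎)

infixr 8 _·ₘ_

_·ₘ_ : ∀ {m} → ℕ → Fin (suc m) → Fin (suc m)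
zero  ·ₘ a = 0F
suc k ·ₘ a = (k ·ₘ a) +ₘ a

toℕ-·ₘ : ∀ {m} k (a : Fin (suc m)) → toℕ (k ·ₘ a) ≡ k * toℕ a % suc m
toℕ-·ₘ         zero    a = refl
toℕ-·ₘ {m} (suc k) a = begin
  toℕ ((k ·ₘ a) +ₘ a)                    ≡⟨ toℕ-+ₘ (k ·ₘ a) a ⟩
  (toℕ (k ·ₘ a) + toℕ a) % suc m         ≡⟨ cong (λ x → (x + toℕ a) % suc m) (toℕ-·ₘ k a) ⟩
  (k * toℕ a % suc m + toℕ a) % suc m    ≡⟨ [a%m+b]%m≡[a+b]%m (suc m) (k * toℕ a) (toℕ a) ⟩
  (k * toℕ a + toℕ a) % suc m            ≡⟨ cong (_% suc m) (+-comm (k * toℕ a) (toℕ a)) ⟩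
  suc k * toℕ a % suc m                  ∎

[d*m]·ₘa≡0 : ∀ {m} d (a : Fin (suc m)) → (d * suc m) ·ₘ a ≡ 0F
[d*m]·ₘa≡0 {m} d a = toℕ-injective (begin
  toℕ ((d * suc m) ·ₘ a)     ≡⟨ toℕ-·ₘ (d * suc m) a ⟩
  d * suc m * toℕ a % suc m  ≡⟨ cong (_% suc m) (*-assoc d (suc m) (toℕ a)) ⟩
  d * (suc m * toℕ a) % suc m ≡⟨ cong (λ x → d * x % suc m) (*-comm (suc m) (toℕ a)) ⟩
  d * (toℕ a * suc m) % suc m ≡⟨ cong (_% suc m) (*-assoc d (toℕ a) (suc m)) ⟨
  d * toℕ a * suc m % suc m  ≡⟨ m*n%n≡0 (d * toℕ a) (suc m) ⟩
  0                          ∎)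

-- The abelian group G n

infix 21 -G_

-G_ : ∀ {n} → G n → G n
-G (a , b) = -ₘ a , -ₘ b

G-abelianGroup : ℕ → AbelianGroup 0ℓ 0ℓ
G-abelianGroup n = record
  { Carrier = G n
  ; _≈_ = _≡_
  ; _∙_ = _+G_
  ; ε = 0G
  ; _⁻¹ = -G_
  ; isAbelianGroup = record
    { isGroup = record
      { isMonoid = record
        { isSemigroup = record
          { isMagma = isMagma _+G_
          ; assoc = λ (a , b) (c , d) (e , h) → cong₂ _,_ (+ₘ-assoc a c e) (+ₘ-assoc b d h)
          }
        ; identity = identityˡ , λ x → trans (comm x 0G) (identityˡ x)
        }
      ; inverse = (λ x → trans (comm (-G x) x) (inverseʳ x)) , inverseʳ
      ; ⁻¹-cong = cong -G_
      }
    ; comm = comm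
    }
  }
  where
  comm : ∀ (x y : G n) → x +G y ≡ y +G x
  comm (a , b) (c , d) = cong₂ _,_ (+ₘ-comm a c) (+ₘ-comm b d)
  identityˡ : ∀ (x : G n) → 0G +G x ≡ x
  identityˡ (a , b) = cong₂ _,_ (+ₘ-identityˡ a) (+ₘ-identityˡ b)
  inverseʳ : ∀ (x : G n) → x +G (-G x) ≡ 0G
  inverseʳ (a , b) = cong₂ _,_ (+ₘ-inverseʳ a) (+ₘ-inverseʳ b)

module Gᴬ {n : ℕ} = AbelianGroup (G-abelianGroup n)
module Gᴾ {n : ℕ} = Algebra.Properties.AbelianGroup (G-abelianGroup n)
open Gᴬ using (_-_; comm; assoc; identityˡ; identityʳ; inverseˡ; inverseʳ)
open Gᴾ using (ε⁻¹≈ε; ⁻¹-involutive; ⁻¹-∙-comm; ⁻¹-anti-homo‿-; inverseˡ-unique; x∙y⁻¹≈ε⇒x≈y; x≈z//y;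
              //-rightDividesˡ; //-rightDividesʳ; ∙-cancelˡ)

module CM {n} = Algebra.Solver.CommutativeMonoid (Gᴬ.commutativeMonoid {n})
open CM using (_⊜_) renaming (_⊕_ to _⊞_)

double : ∀ {n} → G n → G n
double x = x +G x

infixr 8 _·_

_·_ : ∀ {n} → ℕ → G n → G n
k · (a , b) = k ·ₘ a , k ·ₘ b

·-exponent : ∀ {n} (g : G n) → (2 * suc n) · g ≡ 0G
·-exponent {n} (a , b) =
  cong₂ _,_ (subst (λ k → k ·ₘ a ≡ 0F) (*-comm (suc n) 2) ([d*m]·ₘa≡0 (suc n) a)) ([d*m]·ₘa≡0 2 b)

x-0≡x : ∀ {n} (x : G n) → x - 0G ≡ x
x-0≡x x = trans (cong (x +G_) ε⁻¹≈ε) (identityʳ x)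

x-[-y]≡x+y : ∀ {n} (x y : G n) → x - (-G y) ≡ x +G y
x-[-y]≡x+y x y = cong (x +G_) (⁻¹-involutive y)

[x-y]+z≡x+[z-y] : ∀ {n} (x y z : G n) → (x - y) +G z ≡ x +G (z - y)
[x-y]+z≡x+[z-y] x y z = trans (assoc x (-G y) z) (cong (x +G_) (comm (-G y) z))

x-[x-y]≡y : ∀ {n} (x y : G n) → x - (x - y) ≡ y
x-[x-y]≡y x y = begin
  x +G -G (x - y)  ≡⟨ cong (x +G_) (⁻¹-anti-homo‿- x y) ⟩
  x +G (y - x)     ≡⟨ comm x (y - x) ⟩
  (y - x) +G x     ≡⟨ //-rightDividesˡ x y ⟩
  y                ∎

[x-y]-[x-z]≡z-y : ∀ {n} (x y z : G n) → (x - y) - (x - z) ≡ z - y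
[x-y]-[x-z]≡z-y x y z = begin
  (x - y) +G -G (x - z)          ≡⟨ cong ((x - y) +G_) (⁻¹-anti-homo‿- x z) ⟩
  (x +G -G y) +G (z +G -G x)     ≡⟨ CM.solve 4 (λ x -y z -x → (x ⊞ -y) ⊞ (z ⊞ -x) ⊜ (z ⊞ -y) ⊞ (x ⊞ -x))
                                             refl x (-G y) z (-G x) ⟩
  (z - y) +G (x - x)             ≡⟨ cong ((z - y) +G_) (inverseʳ x) ⟩
  (z - y) +G 0G                  ≡⟨ identityʳ (z - y) ⟩
  z - y                          ∎

x-[y+z]≡[x-y]-z : ∀ {n} (x y z : G n) → x - (y +G z) ≡ (x - y) - z
x-[y+z]≡[x-y]-z x y z = trans (cong (x +G_) (sym (⁻¹-∙-comm y z))) (sym (assoc x (-G y) (-G z)))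

-as-multiple : ∀ {n} (u : G n) → ∃ λ e → e · u ≡ -G u
-- suc (n + 1 * suc n) reduces to 2 * suc n.
-as-multiple {n} u = n + 1 * suc n , inverseˡ-unique _ u (·-exponent u)

-≡0⇒≡0 : ∀ {n} {x : G n} → -G x ≡ 0G → x ≡ 0G
-≡0⇒≡0 {x = x} -x≡0 = trans (sym (⁻¹-involutive x)) (trans (cong -G_ -x≡0) ε⁻¹≈ε)

x+y≡x⇒y≡0 : ∀ {n} {x y : G n} → x +G y ≡ x → y ≡ 0G
x+y≡x⇒y≡0 {x = x} {y} eq = ∙-cancelˡ x y 0G (trans eq (sym (identityʳ x)))

x-y≡x⇒y≡0 : ∀ {n} {x y : G n} → x - y ≡ x → y ≡ 0G
x-y≡x⇒y≡0 = -≡0⇒≡0 ∘ x+y≡x⇒y≡0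

x+[y-x]≡y : ∀ {n} (x y : G n) → x +G (y - x) ≡ y
x+[y-x]≡y x y = trans (comm x (y - x)) (//-rightDividesˡ x y)

[x+y]-x≡y : ∀ {n} (x y : G n) → (x +G y) - x ≡ y
[x+y]-x≡y x y = trans (cong (_- x) (comm x y)) (//-rightDividesʳ x y)

[x-y]-x≡-y : ∀ {n} (x y : G n) → (x - y) - x ≡ -G y
[x-y]-x≡-y x y = begin
  (x +G -G y) +G -G x   ≡⟨ CM.solve 3 (λ x -y -x → (x ⊞ -y) ⊞ -x ⊜ -y ⊞ (x ⊞ -x)) refl x (-G y) (-G x) ⟩
  -G y +G (x - x)       ≡⟨ cong (-G y +G_) (inverseʳ x) ⟩
  -G y +G 0G            ≡⟨ identityʳ (-G y) ⟩
  -G y                  ∎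

x-[x+y]≡-y : ∀ {n} (x y : G n) → x - (x +G y) ≡ -G y
x-[x+y]≡-y x y = begin
  x +G -G (x +G y)        ≡⟨ cong (x +G_) (⁻¹-∙-comm x y) ⟨
  x +G (-G x +G -G y)     ≡⟨ assoc x (-G x) (-G y) ⟨
  (x - x) +G -G y         ≡⟨ cong (_+G -G y) (inverseʳ x) ⟩
  0G +G -G y              ≡⟨ identityˡ (-G y) ⟩
  -G y                    ∎

x-[y-z]≡[x-y]+z : ∀ {n} (x y z : G n) → x - (y - z) ≡ (x - y) +G z
x-[y-z]≡[x-y]+z x y z = begin
  x +G -G (y - z)     ≡⟨ cong (x +G_) (⁻¹-anti-homo‿- y z) ⟩
  x +G (z - y)        ≡⟨ [x-y]+z≡x+[z-y] x y z ⟨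
  (x - y) +G z        ∎

[x+y]-z≡y+[x-z] : ∀ {n} (x y z : G n) → (x +G y) - z ≡ y +G (x - z)
[x+y]-z≡y+[x-z] x y z = CM.solve 3 (λ x y -z → (x ⊞ y) ⊞ -z ⊜ y ⊞ (x ⊞ -z)) refl x y (-G z)

[x+z]-[x-y]≡y+z : ∀ {n} (x y z : G n) → (x +G z) - (x - y) ≡ y +G z
[x+z]-[x-y]≡y+z x y z = begin
  (x +G z) +G -G (x - y)        ≡⟨ cong ((x +G z) +G_) (⁻¹-anti-homo‿- x y) ⟩
  (x +G z) +G (y +G -G x)       ≡⟨ CM.solve 4 (λ x z y -x → (x ⊞ z) ⊞ (y ⊞ -x) ⊜ (y ⊞ z) ⊞ (x ⊞ -x)) refl x z y (-G x) ⟩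
  (y +G z) +G (x - x)           ≡⟨ cong ((y +G z) +G_) (inverseʳ x) ⟩
  (y +G z) +G 0G                ≡⟨ identityʳ (y +G z) ⟩
  y +G z                        ∎

double-0 : ∀ {n} → double {n} 0G ≡ 0G
double-0 = identityʳ 0G

double-+ : ∀ {n} (x y : G n) → double (x +G y) ≡ double x +G double y
double-+ x y = CM.solve 2 (λ x y → (x ⊞ y) ⊞ (x ⊞ y) ⊜ (x ⊞ x) ⊞ (y ⊞ y)) refl x y

double-+-cancel : ∀ {n} (x y : G n) → double y ≡ 0G → double (x +G y) ≡ double x
double-+-cancel x y 2y≡0 = trans (double-+ x y) (trans (cong (double x +G_) 2y≡0) (identityʳ (double x)))

double-neg≢0 : ∀ {n} {x : G n} → double x ≢ 0G → double (-G x) ≢ 0G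
double-neg≢0 {x = x} 2x≢0 2[-x]≡0 = 2x≢0 (-≡0⇒≡0 (trans (sym (⁻¹-∙-comm x x)) 2[-x]≡0))

x≡-x⇒double≡0 : ∀ {n} {x : G n} → x ≡ -G x → double x ≡ 0G
x≡-x⇒double≡0 {x = x} eq = trans (cong (x +G_) eq) (inverseʳ x)

infix 4 _≟G_

_≟G_ : ∀ {n} → DecidableEquality (G n)
_≟G_ = ≡-dec Fin._≟_ Fin._≟_

∃?ᴳ : ∀ {n} {P : G n → Set} → Decidable P → Dec (∃ P)
∃?ᴳ P? = map′ (λ (i , j , p) → (i , j) , p) (λ ((i , j) , p) → i , j , p)
               (any? λ i → any? λ j → P? (i , j))

∀?ᴳ : ∀ {n} {P : G n → Set} → Decidable P → Dec (∀ g → P g)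
∀?ᴳ P? = map′ (λ p (i , j) → p i j) (λ p i j → p (i , j)) (all? λ i → all? λ j → P? (i , j))

==G⇒≡ : ∀ {n} {g h : G n} → T (g ==G h) → g ≡ h
==G⇒≡ {g = a , b} {c , d} t with Equivalence.to T-∧ t
... | p , q = cong₂ _,_ (toWitness {a? = a Fin.≟ c} p) (toWitness {a? = b Fin.≟ d} q)

≡⇒==G : ∀ {n} {g h : G n} → g ≡ h → T (g ==G h)
≡⇒==G {g = a , b} refl = Equivalence.from T-∧ (fromWitness {a? = a Fin.≟ a} refl , fromWitness {a? = b Fin.≟ b} refl)

∈-elems : ∀ {n} (g : G n) → g ∈ˡ elems n
∈-elems {n} (i , j) =
  ∈-concatMap⁺ (λ i → map (i ,_) (allFin (suc n))) (lose (∈-allFin i) (∈-map⁺ (i ,_) (∈-allFin j)))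

-- Subsets of G n and the monoid P₀ n

tabulateᴳ : ∀ {n} → (G n → Bool) → Subset n
tabulateᴳ P = tabulate (λ i → tabulate (λ j → P (i , j)))

∈ᵇ-tabulate : ∀ {n} (P : G n → Bool) g → g ∈ᵇ tabulateᴳ P ≡ P g
∈ᵇ-tabulate P (i , j) =
  trans (cong (λ r → lookup r j) (lookup∘tabulate (λ i′ → tabulate (λ j′ → P (i′ , j′))) i))
        (lookup∘tabulate (λ j′ → P (i , j′)) j)

tabulate-∈ᵇ : ∀ {n} (S : Subset n) → tabulateᴳ (_∈ᵇ S) ≡ S
tabulate-∈ᵇ S = trans (tabulate-cong (λ i → tabulate∘lookup (lookup S i))) (tabulate∘lookup S)

Subset-ext : ∀ {n} {S S′ : Subset n} → (∀ g → g ∈ᵇ S ≡ g ∈ᵇ S′) → S ≡ S′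
Subset-ext {S = S} {S′} eq = begin
  S                   ≡⟨ tabulate-∈ᵇ S ⟨
  tabulateᴳ (_∈ᵇ S)   ≡⟨ tabulate-cong (λ i → tabulate-cong (λ j → eq (i , j))) ⟩
  tabulateᴳ (_∈ᵇ S′)  ≡⟨ tabulate-∈ᵇ S′ ⟩
  S′                  ∎

infix 4 _∈_ _∉_ _∈?_ _∉?_

_∈_ : ∀ {n} → G n → P₀ n → Set
g ∈ X = T (g ∈ᵇ proj₁ X)

_∉_ : ∀ {n} → G n → P₀ n → Set
g ∉ X = ¬ g ∈ X

_∈?_ : ∀ {n} (g : G n) X → Dec (g ∈ X)
g ∈? X = T? (g ∈ᵇ proj₁ X)

_∉?_ : ∀ {n} (g : G n) X → Dec (g ∉ X)
g ∉? X = ¬? (g ∈? X)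

∈-stable : ∀ {n} {g : G n} {X} → ¬ g ∉ X → g ∈ X
∈-stable {g = g} {X} = decidable-stable (g ∈? X)

0∈ : ∀ {n} (X : P₀ n) → 0G ∈ X
0∈ = proj₂

¬T⇔¬T⇒≡ : ∀ {a b} → (¬ T a → ¬ T b) → (¬ T b → ¬ T a) → a ≡ b
¬T⇔¬T⇒≡ {true}  {true}  _ _ = refl
¬T⇔¬T⇒≡ {true}  {false} _ h = contradiction _ (h λ ())
¬T⇔¬T⇒≡ {false} {true}  h _ = contradiction _ (h λ ())
¬T⇔¬T⇒≡ {false} {false} _ _ = refl

P₀-≡ : ∀ {n} {X Y : P₀ n} → proj₁ X ≡ proj₁ Y → X ≡ Y
P₀-≡ {X = S , p} {.S , p′} refl = cong (S ,_) (T-irrelevant p p′)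

P₀-ext : ∀ {n} {X Y : P₀ n} → (∀ {g} → g ∉ X → g ∉ Y) → (∀ {g} → g ∉ Y → g ∉ X) → X ≡ Y
P₀-ext {X = X} {Y} X⊆Y Y⊆X = P₀-≡ (Subset-ext {S = proj₁ X} {proj₁ Y} (λ g → ¬T⇔¬T⇒≡ (X⊆Y {g}) (Y⊆X {g})))

T-not-does⁺ : ∀ {A : Set} (a? : Dec A) → ¬ A → T (not (does a?))
T-not-does⁺ a? ¬a = subst (λ b → T (not b)) (sym (dec-false a? ¬a)) _

T-not-does⁻ : ∀ {A : Set} (a? : Dec A) → T (not (does a?)) → ¬ A
T-not-does⁻ a? t a = subst (λ b → T (not b)) (dec-true a? a) t

deleteᵇ : ∀ {n} → G n → P₀ n → G n → Bool
deleteᵇ u X g = g ∈ᵇ proj₁ X ∧ not (does (g ≟G u))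

-- Opaque, so that unification sees these sets as rigid instead of unfolding their vectors.
opaque
  full : ∀ {n} → P₀ n
  full {n} = tabulateᴳ (λ _ → true) , subst T (sym (∈ᵇ-tabulate {n} (λ _ → true) 0G)) _

  ∈-full : ∀ {n} (g : G n) → g ∈ full
  ∈-full g = subst T (sym (∈ᵇ-tabulate (λ _ → true) g)) _

  delete : ∀ {n} (u : G n) → u ≢ 0G → P₀ n → P₀ n
  delete u u≢0 X = tabulateᴳ (deleteᵇ u X) , subst T (sym (∈ᵇ-tabulate (deleteᵇ u X) 0G))
                     (Equivalence.from T-∧ (0∈ X , T-not-does⁺ (0G ≟G u) (u≢0 ∘ sym)))

  ∈-delete⁺ : ∀ {n} {u : G n} {u≢0 : u ≢ 0G} {X g} → g ∈ X → g ≢ u → g ∈ delete u u≢0 X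
  ∈-delete⁺ {u = u} {X = X} {g} g∈X g≢u =
    subst T (sym (∈ᵇ-tabulate (deleteᵇ u X) g)) (Equivalence.from T-∧ (g∈X , T-not-does⁺ (g ≟G u) g≢u))

  ∈-delete⁻ : ∀ {n} {u : G n} {u≢0 : u ≢ 0G} {X g} → g ∈ delete u u≢0 X → g ∈ X × g ≢ u
  ∈-delete⁻ {u = u} {X = X} {g} g∈
    with t , t′ ← Equivalence.to T-∧ (subst T (∈ᵇ-tabulate (deleteᵇ u X) g) g∈) = t , T-not-does⁻ (g ≟G u) t′

full-unique : ∀ {n} {X : P₀ n} → (∀ g → g ∈ X) → X ≡ full
full-unique all∈ = P₀-ext (λ {g} g∉ → contradiction (all∈ g) g∉) (λ {g} g∉ → contradiction (∈-full g) g∉)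

module _ {n} {u : G n} {u≢0 : u ≢ 0G} {X : P₀ n} {g : G n} where

  ∉-delete⁺ : g ∉ X → g ∉ delete u u≢0 X
  ∉-delete⁺ g∉X = g∉X ∘ proj₁ ∘ ∈-delete⁻

  ∉-delete⁻ : g ∉ delete u u≢0 X → g ∉ X ⊎ g ≡ u
  ∉-delete⁻ g∉ with g ≟G u
  ... | yes g≡u = inj₂ g≡u
  ... | no g≢u  = inj₁ (λ g∈X → g∉ (∈-delete⁺ g∈X g≢u))

∉-delete-self : ∀ {n} {u : G n} {u≢0 : u ≢ 0G} {X : P₀ n} → u ∉ delete u u≢0 X
∉-delete-self u∈ = proj₂ (∈-delete⁻ u∈) refl

sumᵇ : ∀ {n} → Subset n → Subset n → G n → Bool
sumᵇ {n} S S′ g = any (λ x → any (λ y → (x ∈ᵇ S) ∧ (y ∈ᵇ S′) ∧ ((x +G y) ==G g)) (elems n)) (elems n)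

module _ {n} (S S′ : Subset n) where

  ∈ᵇ-⊕⁺ : ∀ {x y g} → T (x ∈ᵇ S) → T (y ∈ᵇ S′) → x +G y ≡ g → T (g ∈ᵇ (S ⊕ S′))
  ∈ᵇ-⊕⁺ {x} {y} x∈ y∈ refl = subst T (sym (∈ᵇ-tabulate (sumᵇ S S′) (x +G y)))
    (any⁺ _ (lose (∈-elems x) (any⁺ _ (lose (∈-elems y)
      (Equivalence.from T-∧ (x∈ , Equivalence.from T-∧ (y∈ , ≡⇒==G {g = x +G y} refl)))))))

  ∈ᵇ-⊕⁻ : ∀ {g} → T (g ∈ᵇ (S ⊕ S′)) → ∃₂ λ x y → T (x ∈ᵇ S) × T (y ∈ᵇ S′) × x +G y ≡ g
  ∈ᵇ-⊕⁻ {g} t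
    with x , t₁ ← satisfied (any⁻ _ (elems n) (subst T (∈ᵇ-tabulate (sumᵇ S S′) g) t))
    with y , t₂ ← satisfied (any⁻ _ (elems n) t₁)
    with x∈ , t₃ ← Equivalence.to T-∧ t₂
    with y∈ , x+y≡g ← Equivalence.to T-∧ t₃
    = x , y , x∈ , y∈ , ==G⇒≡ x+y≡g

infixl 6 _⊕ᴾ_

opaque
  _⊕ᴾ_ : ∀ {n} → P₀ n → P₀ n → P₀ n
  X ⊕ᴾ Y = proj₁ X ⊕ proj₁ Y , ∈ᵇ-⊕⁺ (proj₁ X) (proj₁ Y) (0∈ X) (0∈ Y) (identityˡ 0G)

  proj₁-⊕ᴾ : ∀ {n} (X Y : P₀ n) → proj₁ (X ⊕ᴾ Y) ≡ proj₁ X ⊕ proj₁ Y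
  proj₁-⊕ᴾ X Y = refl

  ∈-⊕ᴾ⁺ : ∀ {n} {X Y : P₀ n} {x y g} → x ∈ X → y ∈ Y → x +G y ≡ g → g ∈ X ⊕ᴾ Y
  ∈-⊕ᴾ⁺ {X = X} {Y} = ∈ᵇ-⊕⁺ (proj₁ X) (proj₁ Y)

  ∈-⊕ᴾ⁻ : ∀ {n} {X Y : P₀ n} {g} → g ∈ X ⊕ᴾ Y → ∃₂ λ x y → x ∈ X × y ∈ Y × x +G y ≡ g
  ∈-⊕ᴾ⁻ {X = X} {Y} = ∈ᵇ-⊕⁻ (proj₁ X) (proj₁ Y)

∈-pair0ᴾ⁻ : ∀ {n} {a g : G n} → g ∈ pair0ᴾ a → g ≡ 0G ⊎ g ≡ a
∈-pair0ᴾ⁻ {a = a} {g} g∈ with Equivalence.to T-∨ (subst T (∈ᵇ-tabulate (λ g → (g ==G 0G) ∨ (g ==G a)) g) g∈)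
... | inj₁ t = inj₁ (==G⇒≡ t)
... | inj₂ t = inj₂ (==G⇒≡ t)

∈-pair0ᴾ-self : ∀ {n} (a : G n) → a ∈ pair0ᴾ a
∈-pair0ᴾ-self a = subst T (sym (∈ᵇ-tabulate (λ g → (g ==G 0G) ∨ (g ==G a)) a))
  (Equivalence.from (T-∨ {a ==G 0G}) (inj₂ (≡⇒==G {g = a} refl)))

opaque
  σ : ∀ {n} → G n → P₀ n → P₀ n
  σ a X = X ⊕ᴾ pair0ᴾ a

  σ-def : ∀ {n} (a : G n) X → σ a X ≡ X ⊕ᴾ pair0ᴾ a
  σ-def a X = refl

  ∉-σ⁻ : ∀ {n} {a g : G n} {X} → g ∉ σ a X → g ∉ X × g - a ∉ X
  ∉-σ⁻ {a = a} {g} g∉ = (λ g∈X → g∉ (∈-⊕ᴾ⁺ g∈X (0∈ (pair0ᴾ a)) (identityʳ g)))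
                      , (λ g-a∈X → g∉ (∈-⊕ᴾ⁺ g-a∈X (∈-pair0ᴾ-self a) (//-rightDividesˡ a g)))

  ∉-σ⁺ : ∀ {n} {a g : G n} {X} → g ∉ X → g - a ∉ X → g ∉ σ a X
  ∉-σ⁺ {a = a} {g} {X} g∉X g-a∉X g∈ with x , y , x∈ , y∈ , x+y≡g ← ∈-⊕ᴾ⁻ g∈ with ∈-pair0ᴾ⁻ {a = a} {g = y} y∈
  ... | inj₁ refl = g∉X (subst (_∈ X) (trans (sym (identityʳ x)) x+y≡g) x∈)
  ... | inj₂ refl = g-a∉X (subst (_∈ X) (x≈z//y x a g x+y≡g) x∈)

full-⊕ᴾ : ∀ {n} (X : P₀ n) → full ⊕ᴾ X ≡ full
full-⊕ᴾ X = full-unique λ g → ∈-⊕ᴾ⁺ (∈-full g) (0∈ X) (identityʳ g)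

⊕ᴾ-full : ∀ {n} (X : P₀ n) → X ⊕ᴾ full ≡ full
⊕ᴾ-full X = full-unique λ g → ∈-⊕ᴾ⁺ (0∈ X) (∈-full g) (identityˡ g)

-- Counting missing points

count : ∀ {k} {P : Pred (Fin k) 0ℓ} → Decidable P → ℕ
count {zero}  P? = 0
count {suc k} P? = if does (P? 0F) then suc (count (P? ∘ Fin.suc)) else count (P? ∘ Fin.suc)

count-mono : ∀ {k} {P Q : Pred (Fin k) 0ℓ} (P? : Decidable P) (Q? : Decidable Q) → P ⊆ Q → count P? ≤ count Q?
count-mono {zero}  P? Q? P⊆Q = z≤n
count-mono {suc k} P? Q? P⊆Q with P? 0F | Q? 0F | count-mono (P? ∘ Fin.suc) (Q? ∘ Fin.suc) P⊆Q
... | yes _ | yes _  | rec = s≤s rec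
... | yes p | no ¬q  | _   = contradiction (P⊆Q p) ¬q
... | no _  | yes _  | rec = m≤n⇒m≤1+n rec
... | no _  | no _   | rec = rec

count-cong : ∀ {k} {P Q : Pred (Fin k) 0ℓ} (P? : Decidable P) (Q? : Decidable Q) → P ⊆ Q → Q ⊆ P → count P? ≡ count Q?
count-cong P? Q? P⊆Q Q⊆P = ≤-antisym (count-mono P? Q? P⊆Q) (count-mono Q? P? Q⊆P)

count-none : ∀ {k} {P : Pred (Fin k) 0ℓ} (P? : Decidable P) → (∀ {i} → ¬ P i) → count P? ≡ 0
count-none {zero}  P? ¬P = refl
count-none {suc k} P? ¬P with P? 0F
... | yes p = contradiction p ¬P
... | no _  = count-none (P? ∘ Fin.suc) ¬P

_∖?_ : ∀ {k} {P : Pred (Fin k) 0ℓ} → Decidable P → (j : Fin k) → Decidable (λ i → P i × i ≢ j)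
(P? ∖? j) i = P? i ×-dec ¬? (i Fin.≟ j)

count-∖ : ∀ {k} {P : Pred (Fin k) 0ℓ} (P? : Decidable P) {j} → P j → count P? ≡ suc (count (P? ∖? j))
count-∖ {suc k} P? {0F} p with P? 0F
... | yes _ = cong suc (count-cong (P? ∘ Fin.suc) ((P? ∖? 0F) ∘ Fin.suc) (λ p → p , λ ()) proj₁)
... | no ¬p = contradiction p ¬p
count-∖ {suc k} P? {Fin.suc j} p
  with P? 0F | trans (count-∖ (P? ∘ Fin.suc) p)
                      (cong suc (count-cong ((P? ∘ Fin.suc) ∖? j) ((P? ∖? Fin.suc j) ∘ Fin.suc)
                        (λ (p , i≢j) → p , i≢j ∘ suc-injective) (λ (p , i≢j) → p , i≢j ∘ cong Fin.suc)))
... | yes _ | rec = cong suc rec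
... | no _  | rec = rec

count-≤-suc-∖ : ∀ {k} {P : Pred (Fin k) 0ℓ} (P? : Decidable P) j → count P? ≤ suc (count (P? ∖? j))
count-≤-suc-∖ P? j with P? j
... | yes p = ≤-reflexive (count-∖ P? p)
... | no ¬p = m≤n⇒m≤1+n (count-mono P? (P? ∖? j) (λ p → p , λ { refl → ¬p p }))

count-< : ∀ {k} {P Q : Pred (Fin k) 0ℓ} (P? : Decidable P) (Q? : Decidable Q) {j} →
          P ⊆ Q → ¬ P j → Q j → count P? < count Q?
count-< P? Q? P⊆Q ¬p q = subst (count P? <_) (sym (count-∖ Q? q))
  (s≤s (count-mono P? (Q? ∖? _) λ p → P⊆Q p , λ { refl → ¬p p }))

count-≤-length : ∀ {k} {P : Pred (Fin k) 0ℓ} (P? : Decidable P) is → (∀ {i} → P i → i ∈ˡ is) → count P? ≤ length is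
count-≤-length P? []       P⊆is = ≤-reflexive (count-none P? (λ p → case P⊆is p of λ ()))
count-≤-length P? (j ∷ is) P⊆is = ≤-trans (count-≤-suc-∖ P? j)
  (s≤s (count-≤-length (P? ∖? j) is (λ (p , i≢j) → tail i≢j (P⊆is p))))

length-≤-count : ∀ {k} {P : Pred (Fin k) 0ℓ} (P? : Decidable P) {is} → Unique is → (∀ {i} → i ∈ˡ is → P i) →
                 length is ≤ count P?
length-≤-count P? {[]}     []              is⊆P = z≤n
length-≤-count P? {j ∷ is} (j∉is ∷ unique) is⊆P = subst (suc (length is) ≤_) (sym (count-∖ P? (is⊆P (here refl))))
  (s≤s (length-≤-count (P? ∖? j) unique (λ i∈ → is⊆P (there i∈) , λ { refl → All.lookup j∉is i∈ refl })))

index : ∀ {n} → G n → Fin (2 * suc n)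
index (i , j) = combine i j

point : ∀ {n} → Fin (2 * suc n) → G n
point {n} = remQuot (suc n)

point-index : ∀ {n} (g : G n) → point (index g) ≡ g
point-index (i , j) = remQuot-combine i j

index-point : ∀ {n} (k : Fin (2 * suc n)) → index (point k) ≡ k
index-point {n} = combine-remQuot {2} (suc n)

index-injective : ∀ {n} {g h : G n} → index g ≡ index h → g ≡ h
index-injective {g = g} {h} eq = trans (sym (point-index g)) (trans (cong point eq) (point-index h))

missing? : ∀ {n} (X : P₀ n) → Decidable (λ k → point k ∉ X)
missing? X k = point k ∉? X

opaque
  missing : ∀ {n} → P₀ n → ℕ
  missing X = count (missing? X)

  missing-< : ∀ {n} {X Y : P₀ n} {g} → (∀ {h} → h ∉ X → h ∉ Y) → ¬ g ∉ X → g ∉ Y → missing X < missing Y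
  missing-< {X = X} {Y} {g} X⊆Y g∈X g∉Y = count-< (missing? X) (missing? Y) {j = index g} X⊆Y
    (subst (λ h → ¬ h ∉ X) (sym (point-index g)) g∈X) (subst (_∉ Y) (sym (point-index g)) g∉Y)

  missing-≤-length : ∀ {n} {X : P₀ n} us → (∀ {g} → g ∉ X → g ∈ˡ us) → missing X ≤ length us
  missing-≤-length {X = X} us X⊆us = subst (missing X ≤_) (length-map index us)
    (count-≤-length (missing? X) (map index us) λ {k} k∉X →
      subst (_∈ˡ map index us) (index-point k) (∈-map⁺ index (X⊆us k∉X)))

  length-≤-missing : ∀ {n} {X : P₀ n} {ds} → Unique ds → (∀ {g} → g ∈ˡ ds → g ∉ X) → length ds ≤ missing X
  length-≤-missing {X = X} {ds} unique ds⊆X = subst (_≤ missing X) (length-map index ds)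
    (length-≤-count (missing? X) (Unique.map⁺ index-injective unique) λ k∈ →
      let g , g∈ds , k≡ = ∈-map⁻ index k∈ in subst (λ k → point k ∉ X) (sym k≡)
        (subst (_∉ X) (sym (point-index g)) (ds⊆X g∈ds)))

∈-pair : ∀ {A : Set} {g x y : A} → g ≡ x ⊎ g ≡ y → g ∈ˡ x ∷ y ∷ []
∈-pair (inj₁ refl) = here refl
∈-pair (inj₂ refl) = there (here refl)

missing-≤-2 : ∀ {n} {X : P₀ n} {x y} → (∀ {g} → g ∉ X → g ≡ x ⊎ g ≡ y) → missing X ≤ 2
missing-≤-2 X⊆xy = missing-≤-length (_ ∷ _ ∷ []) (∈-pair ∘ X⊆xy)

missing-≤-1 : ∀ {n} {X : P₀ n} {x y} → (∀ {g} → g ∉ X → g ≡ x ⊎ g ≡ y) → x ∈ X → missing X ≤ 1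
missing-≤-1 {x = x} {y} X⊆xy x∈X = missing-≤-length (y ∷ []) λ g∉X → case X⊆xy g∉X of λ where
  (inj₁ refl) → contradiction x∈X g∉X
  (inj₂ refl) → here refl

-- Periods

record Period {n} (X : P₀ n) (u : G n) : Set where
  constructor period
  field shift : ∀ z → z ∈ᵇ proj₁ X ≡ (z +G u) ∈ᵇ proj₁ X

period? : ∀ {n} (X : P₀ n) → Decidable (Period X)
period? X u = map′ period Period.shift (∀?ᴳ λ z → (z ∈ᵇ proj₁ X) Bool.≟ ((z +G u) ∈ᵇ proj₁ X))

module _ {n} {X : P₀ n} where

  Period-∉⁺ : ∀ {u z} → Period X u → z ∉ X → z +G u ∉ X
  Period-∉⁺ {z = z} (period per) = subst (λ b → ¬ T b) (per z)

  Period-∉⁻ : ∀ {u z} → Period X u → z +G u ∉ X → z ∉ X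
  Period-∉⁻ {z = z} (period per) = subst (λ b → ¬ T b) (sym (per z))

  Period-0 : Period X 0G
  Period-0 = period λ z → cong (_∈ᵇ proj₁ X) (sym (identityʳ z))

  Period-sub : ∀ {u w} → Period X u → Period X w → Period X (u - w)
  Period-sub {u} {w} (period per-u) (period per-w) = period λ z → begin
    z ∈ᵇ proj₁ X                ≡⟨ cong (_∈ᵇ proj₁ X) (//-rightDividesˡ w z) ⟨
    ((z - w) +G w) ∈ᵇ proj₁ X   ≡⟨ per-w (z - w) ⟨
    (z - w) ∈ᵇ proj₁ X          ≡⟨ per-u (z - w) ⟩
    ((z - w) +G u) ∈ᵇ proj₁ X   ≡⟨ cong (_∈ᵇ proj₁ X) ([x-y]+z≡x+[z-y] z w u) ⟩
    (z +G (u - w)) ∈ᵇ proj₁ X   ∎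

  -- The only use of finiteness: -u is a multiple of u.
  closed⇒Period : ∀ {u} → (∀ {g} → g ∉ X → g - u ∉ X) → Period X u
  closed⇒Period {u} closed = period λ z → ¬T⇔¬T⇒≡ (z∉⇒z+u∉ {z}) (z+u∉⇒z∉ {z})
    where
    iterate : ∀ k {g} → g ∉ X → g - k · u ∉ X
    iterate zero    {g} g∉X = subst (_∉ X) (sym (x-0≡x g)) g∉X
    iterate (suc k) {g} g∉X = subst (_∉ X) (sym (x-[y+z]≡[x-y]-z g (k · u) u)) (closed (iterate k g∉X))
    z∉⇒z+u∉ : ∀ {z} → z ∉ X → z +G u ∉ X
    z∉⇒z+u∉ {z} z∉X with e , e·u≡-u ← -as-multiple u =
      subst (_∉ X) (trans (cong (z -_) e·u≡-u) (x-[-y]≡x+y z u)) (iterate e z∉X)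
    z+u∉⇒z∉ : ∀ {z} → z +G u ∉ X → z ∉ X
    z+u∉⇒z∉ {z} z+u∉X = subst (_∉ X) (//-rightDividesʳ u z) (closed z+u∉X)

Period-full : ∀ {n} (u : G n) → Period full u
Period-full u = period λ z → trans (Equivalence.to T-≡ (∈-full z)) (sym (Equivalence.to T-≡ (∈-full (z +G u))))

-- Sets that agree on all differences outside a subgroup

module _ {n} {H : G n → Set} (H? : Decidable H) (H-sub : ∀ {u w} → H u → H w → H (u - w)) where

  transfer : ∀ {A B : G n → Set} {x₀ y₀} → A x₀ → A y₀ → ¬ H (x₀ - y₀) →
             (∀ {c x} → ¬ H c → A x → A (x - c) → B x) → ∀ {x} → A x → B x
  transfer {A} {B} {x₀} {y₀} Ax₀ Ay₀ ¬Hx₀-y₀ step {x} Ax with H? (x - y₀) | H? (x - x₀)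
  ... | no ¬h  | _      = step ¬h Ax (subst A (sym (x-[x-y]≡y x y₀)) Ay₀)
  ... | yes _  | no ¬h  = step ¬h Ax (subst A (sym (x-[x-y]≡y x x₀)) Ax₀)
  ... | yes h₁ | yes h₂ = contradiction (subst H ([x-y]-[x-z]≡z-y x y₀ x₀) (H-sub h₁ h₂)) ¬Hx₀-y₀

  transfer⇔ : ∀ {A B : G n → Set} {x₀ y₀} → A x₀ → A y₀ → ¬ H (x₀ - y₀) →
              (∀ {c x} → ¬ H c → A x → A (x - c) → B x) → (∀ {c x} → ¬ H c → B x → B (x - c) → A x) →
              (∀ {x} → A x → B x) × (∀ {x} → B x → A x)
  transfer⇔ {A} {B} {x₀} {y₀} Ax₀ Ay₀ ¬Hx₀-y₀ A→B B→A =
    A⊆B , transfer {B} {A} {x₀} {y₀} (A⊆B Ax₀) (A⊆B Ay₀) ¬Hx₀-y₀ B→A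
    where
    A⊆B : ∀ {x} → A x → B x
    A⊆B = transfer {A} {B} {x₀} {y₀} Ax₀ Ay₀ ¬Hx₀-y₀ A→B

σ-delete : ∀ {n} {X : P₀ n} {p z : G n} {z≢0 : z ≢ 0G} → Period X p → p ≢ 0G → z ∈ X →
           σ p (delete z z≢0 X) ≡ X
σ-delete {X = X} {p} {z} per p≢0 z∈X = P₀-ext σZ⊆X X⊆σZ
  where
  σZ⊆X : ∀ {g} → g ∉ σ p (delete z _ X) → g ∉ X
  σZ⊆X {g} g∉ with ∉-σ⁻ g∉
  ... | g∉Z , g-p∉Z with ∉-delete⁻ g-p∉Z
  ...   | inj₁ g-p∉X = subst (_∉ X) (//-rightDividesˡ p g) (Period-∉⁺ per g-p∉X)
  ...   | inj₂ g-p≡z with ∉-delete⁻ g∉Z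
  ...     | inj₁ g∉X = g∉X
  ...     | inj₂ g≡z = contradiction (x-y≡x⇒y≡0 (trans g-p≡z (sym g≡z))) p≢0
  X⊆σZ : ∀ {g} → g ∉ X → g ∉ σ p (delete z _ X)
  X⊆σZ {g} g∉X = ∉-σ⁺ (∉-delete⁺ g∉X)
    (∉-delete⁺ (Period-∉⁻ per (subst (_∉ X) (sym (//-rightDividesˡ p g)) g∉X)))

G∖ : ∀ {n} (c : G n) → c ≢ 0G → P₀ n
G∖ c c≢0 = delete c c≢0 full

∉-G∖⁻ : ∀ {n} {c g : G n} {c≢0 : c ≢ 0G} → g ∉ G∖ c c≢0 → g ≡ c
∉-G∖⁻ {g = g} g∉ with ∉-delete⁻ g∉
... | inj₁ g∉full = contradiction (∈-full g) g∉full
... | inj₂ g≡c    = g≡c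

∉⇒≢0 : ∀ {n} (X : P₀ n) {c} → c ∉ X → c ≢ 0G
∉⇒≢0 X c∉X refl = c∉X (0∈ X)

G∖-unique : ∀ {n} {X : P₀ n} {c} (c∉X : c ∉ X) → (∀ {g} → g ∉ X → g ≡ c) → X ≡ G∖ c (∉⇒≢0 X c∉X)
G∖-unique {X = X} {c} c∉X only-c = P₀-ext {X = X} {G∖ c (∉⇒≢0 X c∉X)}
  (λ g∉X → subst (_∉ G∖ c _) (sym (only-c g∉X)) ∉-delete-self) (λ g∉ → subst (_∉ X) (sym (∉-G∖⁻ g∉)) c∉X)

σ-two-point : ∀ {n} {Y : P₀ n} {c d} {c≢0 : c ≢ 0G} → (∀ {g} → g ∉ Y → g ≡ c ⊎ g ≡ d) → c ∉ Y → d ∉ Y →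
              double (c - d) ≢ 0G → σ (c - d) Y ≡ G∖ c c≢0
σ-two-point {Y = Y} {c} {d} Y⊆cd c∉Y d∉Y 2[c-d]≢0 = P₀-ext σY⊆G∖c G∖c⊆σY
  where
  σY⊆G∖c : ∀ {g} → g ∉ σ (c - d) Y → g ∉ G∖ c _
  σY⊆G∖c {g} g∉ with ∉-σ⁻ g∉
  ... | g∉Y , g-δ∉Y with Y⊆cd g∉Y | Y⊆cd g-δ∉Y
  ...   | inj₁ g≡c | _       = subst (_∉ G∖ c _) (sym g≡c) ∉-delete-self
  ...   | inj₂ g≡d | inj₁ g-δ≡c = contradiction (x≡-x⇒double≡0 c-d≡-[c-d]) 2[c-d]≢0
    where c-d≡-[c-d] = trans (cong (_- d) (sym (trans (cong (_- (c - d)) (sym g≡d)) g-δ≡c))) ([x-y]-x≡-y d (c - d))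
  ...   | inj₂ g≡d | inj₂ g-δ≡d =
    contradiction (trans (cong double (x-y≡x⇒y≡0 {x = g} {c - d} (trans g-δ≡d (sym g≡d)))) double-0) 2[c-d]≢0
  G∖c⊆σY : ∀ {g} → g ∉ G∖ c _ → g ∉ σ (c - d) Y
  G∖c⊆σY g∉ with refl ← ∉-G∖⁻ g∉ = ∉-σ⁺ c∉Y (subst (_∉ Y) (sym (x-[x-y]≡y c d)) d∉Y)

MissingInCoset : ∀ {n} → P₀ n → Set
MissingInCoset X = ∀ {x y} → x ∉ X → y ∉ X → Period X (x - y)

module _ {n} {X : P₀ n} (coset : MissingInCoset X) {z : G n} {z≢0 : z ≢ 0G} {b : G n} (¬per : ¬ Period X b) where

  ∉-σ-delete⁻ : ∀ {g} → g ∉ σ b (delete z z≢0 X) → g ≡ z ⊎ g ≡ z +G b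
  ∉-σ-delete⁻ {g} g∉ with ∉-σ⁻ g∉
  ... | g∉Z , g-b∉Z with ∉-delete⁻ g∉Z | ∉-delete⁻ g-b∉Z
  ...   | inj₂ g≡z  | _           = inj₁ g≡z
  ...   | inj₁ _    | inj₂ g-b≡z  = inj₂ (trans (sym (//-rightDividesˡ b g)) (cong (_+G b) g-b≡z))
  ...   | inj₁ g∉X  | inj₁ g-b∉X  = contradiction (subst (Period X) (x-[x-y]≡y g b) (coset g∉X g-b∉X)) ¬per

  σ-delete-aperiodic : z ∉ σ b (delete z z≢0 X) → (z - b ∉ X → double b ≢ 0G) → ¬ Period (σ b (delete z z≢0 X)) b
  σ-delete-aperiodic z∉T 2b≢0 per-b with ∉-σ-delete⁻ (Period-∉⁺ per-b (Period-∉⁺ per-b z∉T))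
  ... | inj₂ z+b+b≡z+b = ¬per (subst (Period X) (sym (x+y≡x⇒y≡0 z+b+b≡z+b)) Period-0)
  ... | inj₁ z+b+b≡z with ∉-delete⁻ (proj₂ (∉-σ⁻ z∉T))
  ...   | inj₁ z-b∉X = 2b≢0 z-b∉X (x+y≡x⇒y≡0 (trans (sym (assoc z b b)) z+b+b≡z))
  ...   | inj₂ z-b≡z = ¬per (subst (Period X) (sym (x-y≡x⇒y≡0 z-b≡z)) Period-0)

avoid-0 : ∀ {n} {v : G n} → double v ≢ 0G → ∀ c → ∃ λ w → double w ≢ 0G × c +G w ≢ 0G
avoid-0 {v = v} 2v≢0 c with c +G v ≟G 0G
... | no c+v≢0  = v , 2v≢0 , c+v≢0
... | yes c+v≡0 = -G v , double-neg≢0 {x = v} 2v≢0 ,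
  λ c-v≡0 → double-neg≢0 {x = v} 2v≢0 (trans (cong (_+G -G v) (sym (inverseˡ-unique c v c+v≡0))) c-v≡0)

-- Automorphisms with trivial pullback

module _ {n} {f : P₀ n → P₀ n} (aut : IsAutomorphism f) (triv : TrivialPullback f) where
  open IsAutomorphism aut

  f-⊕ᴾ : ∀ X Y → f (X ⊕ᴾ Y) ≡ f X ⊕ᴾ f Y
  f-⊕ᴾ X Y = P₀-≡ (trans (hom X Y (X ⊕ᴾ Y) (proj₁-⊕ᴾ X Y)) (sym (proj₁-⊕ᴾ (f X) (f Y))))

  f-σ : ∀ a X → f (σ a X) ≡ σ a (f X)
  f-σ a X = begin
    f (σ a X)                  ≡⟨ cong f (σ-def a X) ⟩
    f (X ⊕ᴾ pair0ᴾ a)          ≡⟨ f-⊕ᴾ X (pair0ᴾ a) ⟩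
    f X ⊕ᴾ f (pair0ᴾ a)        ≡⟨ cong (f X ⊕ᴾ_) (triv a) ⟩
    f X ⊕ᴾ pair0ᴾ a            ≡⟨ σ-def a (f X) ⟨
    σ a (f X)                  ∎

  f-full : f full ≡ full
  f-full with Y , fY≡full ← surjective full = begin
    f full             ≡⟨ cong f (full-⊕ᴾ Y) ⟨
    f (full ⊕ᴾ Y)      ≡⟨ f-⊕ᴾ full Y ⟩
    f full ⊕ᴾ f Y      ≡⟨ cong (f full ⊕ᴾ_) fY≡full ⟩
    f full ⊕ᴾ full     ≡⟨ ⊕ᴾ-full (f full) ⟩
    full               ∎

  f-missing : ∀ {X : P₀ n} {g₀} → g₀ ∉ X → ∃ (_∉ f X)
  f-missing {X} {g₀} g₀∉X with ∃?ᴳ (_∉? f X)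
  ... | yes gap = gap
  ... | no ¬gap = contradiction (subst (g₀ ∈_) (sym X≡full) (∈-full g₀)) g₀∉X
    where X≡full = injective X full (trans (full-unique λ g → ∈-stable {X = f X} (λ g∉ → ¬gap (g , g∉))) (sym f-full))

  fixed-if-shifts-fixed : ∀ (Z : P₀ n) {Y : P₀ n} {x₀ y₀} → x₀ ∉ Y → y₀ ∉ Y → ¬ Period Z (x₀ - y₀) →
                          (∀ {c} → ¬ Period Z c → f (σ c Y) ≡ σ c Y) → f Y ≡ Y
  fixed-if-shifts-fixed Z {Y} {x₀} {y₀} x₀∉Y y₀∉Y ¬per shifts-fixed = P₀-ext (proj₂ Y⇔fY) (proj₁ Y⇔fY)
    where
    Y→fY : ∀ {c x} → ¬ Period Z c → x ∉ Y → x - c ∉ Y → x ∉ f Y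
    Y→fY {c} {x} ¬per-c x∉ x-c∉ =
      proj₁ (∉-σ⁻ (subst (x ∉_) (trans (sym (shifts-fixed ¬per-c)) (f-σ c Y)) (∉-σ⁺ x∉ x-c∉)))
    fY→Y : ∀ {c x} → ¬ Period Z c → x ∉ f Y → x - c ∉ f Y → x ∉ Y
    fY→Y {c} {x} ¬per-c x∉ x-c∉ =
      proj₁ (∉-σ⁻ (subst (x ∉_) (trans (sym (f-σ c Y)) (shifts-fixed ¬per-c)) (∉-σ⁺ x∉ x-c∉)))
    Y⇔fY = transfer⇔ (period? Z) (Period-sub {X = Z}) {_∉ Y} {_∉ f Y} {x₀} {y₀} x₀∉Y y₀∉Y ¬per Y→fY fY→Y

  FixedBelow : ℕ → Set
  FixedBelow k = ∀ Y → missing Y < k → f Y ≡ Y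

  σ-shrinks : ∀ {Y : P₀ n} {c} → ¬ Period Y c → missing (σ c Y) < missing Y
  σ-shrinks {Y} {c} ¬per with ∃?ᴳ (λ x → x ∉? Y ×-dec x - c ∈? Y)
  ... | yes (x , x∉Y , x-c∈Y) = missing-< {X = σ c Y} {Y} (proj₁ ∘ ∉-σ⁻) (λ x∉σ → proj₂ (∉-σ⁻ x∉σ) x-c∈Y) x∉Y
  ... | no ¬gap = contradiction (closed⇒Period {X = Y} λ {g} g∉Y g-c∈Y → ¬gap (g , g∉Y , g-c∈Y)) ¬per

  fixed-if-aperiodic : ∀ {Y : P₀ n} {x₀ y₀} → FixedBelow (missing Y) → x₀ ∉ Y → y₀ ∉ Y → ¬ Period Y (x₀ - y₀) → f Y ≡ Y
  fixed-if-aperiodic {Y} fixed x₀∉Y y₀∉Y ¬per =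
    fixed-if-shifts-fixed Y x₀∉Y y₀∉Y ¬per (λ {c} ¬per-c → fixed (σ c Y) (σ-shrinks {Y} {c} ¬per-c))

  fixed-by-deleting : ∀ {X : P₀ n} {p c z : G n} {z≢0 : z ≢ 0G} → Period X p → p ≢ 0G → c ∉ X → z ∈ X →
                      (∀ {b} → ¬ Period X b → f (σ b (delete z z≢0 X)) ≡ σ b (delete z z≢0 X)) → f X ≡ X
  fixed-by-deleting {X} {p} {c} {z} {z≢0} per p≢0 c∉X z∈X shifts-fixed = begin
    f X          ≡⟨ cong f (σ-delete per p≢0 z∈X) ⟨
    f (σ p Z)    ≡⟨ f-σ p Z ⟩
    σ p (f Z)    ≡⟨ cong (σ p) fZ≡Z ⟩
    σ p Z        ≡⟨ σ-delete per p≢0 z∈X ⟩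
    X            ∎
    where
    Z = delete z z≢0 X
    ¬per : ¬ Period X (z - c)
    ¬per per-zc = Period-∉⁺ per-zc c∉X (subst (_∈ X) (sym (x+[y-x]≡y c z)) z∈X)
    fZ≡Z : f Z ≡ Z
    fZ≡Z = fixed-if-shifts-fixed X {Z} {z} {c} ∉-delete-self (∉-delete⁺ c∉X) ¬per shifts-fixed

  f-G∖-unique : ∀ {c u w : G n} {c≢0 : c ≢ 0G} → u ∉ f (G∖ c c≢0) → w ∉ f (G∖ c c≢0) → u ≡ w
  f-G∖-unique {c} {u} {w} {c≢0} u∉ w∉ = decidable-stable (u ≟G w) λ u≢w →
    subst (u ∉_) (σf≡full u≢w) (∉-σ⁺ u∉ (subst (_∉ f (G∖ c c≢0)) (sym (x-[x-y]≡y u w)) w∉)) (∈-full u)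
    where
    σf≡full : u ≢ w → σ (u - w) (f (G∖ c c≢0)) ≡ full
    σf≡full u≢w = begin
      σ (u - w) (f (G∖ c c≢0))   ≡⟨ f-σ (u - w) (G∖ c c≢0) ⟨
      f (σ (u - w) (G∖ c c≢0))   ≡⟨ cong f (σ-delete (Period-full (u - w)) (u≢w ∘ x∙y⁻¹≈ε⇒x≈y u w) (∈-full c)) ⟩
      f full                     ≡⟨ f-full ⟩
      full                       ∎

  shift-missing : ∀ c d t {c≢0 : c ≢ 0G} {d≢0 : d ≢ 0G} → double (c - d) ≢ 0G →
                  c +G t ∉ f (G∖ c c≢0) → d +G t ∉ f (G∖ d d≢0)
  shift-missing c d t {c≢0} {d≢0} 2[c-d]≢0 c+t∉ =
    subst (d +G t ∉_) (trans (sym (f-σ (d - c) Y)) (cong f σY≡G∖d))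
      (∉-σ⁺ d+t∉fY (subst (_∉ f Y) (sym ([x+z]-[x-y]≡y+z d c t)) c+t∉fY))
    where
    Y = delete d d≢0 (G∖ c c≢0)
    Y⊆cd : ∀ {g} → g ∉ Y → g ≡ c ⊎ g ≡ d
    Y⊆cd g∉ with ∉-delete⁻ g∉
    ... | inj₁ g∉G∖c = inj₁ (∉-G∖⁻ g∉G∖c)
    ... | inj₂ g≡d   = inj₂ g≡d
    c∉Y : c ∉ Y
    c∉Y = ∉-delete⁺ ∉-delete-self
    2[d-c]≢0 : double (d - c) ≢ 0G
    2[d-c]≢0 = subst (λ x → double x ≢ 0G) (⁻¹-anti-homo‿- c d) (double-neg≢0 {x = c - d} 2[c-d]≢0)
    σY≡G∖c : σ (c - d) Y ≡ G∖ c c≢0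
    σY≡G∖c = σ-two-point Y⊆cd c∉Y ∉-delete-self 2[c-d]≢0
    σY≡G∖d : σ (d - c) Y ≡ G∖ d d≢0
    σY≡G∖d = σ-two-point (swap ∘ Y⊆cd) ∉-delete-self c∉Y 2[d-c]≢0
    c+t∉σfY : c +G t ∉ σ (c - d) (f Y)
    c+t∉σfY = subst (c +G t ∉_) (trans (cong f (sym σY≡G∖c)) (f-σ (c - d) Y)) c+t∉
    c+t∉fY : c +G t ∉ f Y
    c+t∉fY = proj₁ (∉-σ⁻ c+t∉σfY)
    d+t∉fY : d +G t ∉ f Y
    d+t∉fY = subst (_∉ f Y) ([x+z]-[x-y]≡y+z c d t) (proj₂ (∉-σ⁻ c+t∉σfY))

  module _ {v : G n} (2v≢0 : double v ≢ 0G) where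

    f-G∖-missing : ∀ {c u : G n} {c≢0 : c ≢ 0G} → u ∉ f (G∖ c c≢0) → u ≡ c
    f-G∖-missing {c} {u} {c≢0} u∉ = decidable-stable (u ≟G c) λ u≢c →
      subst (_∉ f (G∖ (-G t) (-t≢0 u≢c))) (inverseˡ t) (reach (-t≢0 u≢c)) (0∈ (f (G∖ (-G t) (-t≢0 u≢c))))
      where
      t = u - c
      -t≢0 : u ≢ c → -G t ≢ 0G
      -t≢0 u≢c = u≢c ∘ x∙y⁻¹≈ε⇒x≈y u c ∘ -≡0⇒≡0
      c+t∉ : c +G t ∉ f (G∖ c c≢0)
      c+t∉ = subst (_∉ f (G∖ c c≢0)) (sym (x+[y-x]≡y c u)) u∉
      reach : ∀ {e} (e≢0 : e ≢ 0G) → e +G t ∉ f (G∖ e e≢0)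
      reach {e} e≢0 with double (c - e) ≟G 0G
      ... | no 2[c-e]≢0 = shift-missing c e t 2[c-e]≢0 c+t∉
      ... | yes 2[c-e]≡0 with w , 2w≢0 , c+w≢0 ← avoid-0 {v = v} 2v≢0 c =
        shift-missing (c +G w) e t {c+w≢0} 2[c+w-e]≢0 (shift-missing c (c +G w) t 2[c-[c+w]]≢0 c+t∉)
        where
        2[c-[c+w]]≢0 : double (c - (c +G w)) ≢ 0G
        2[c-[c+w]]≢0 = subst (λ x → double x ≢ 0G) (sym (x-[x+y]≡-y c w)) (double-neg≢0 {x = w} 2w≢0)
        2[c+w-e]≢0 : double ((c +G w) - e) ≢ 0G
        2[c+w-e]≢0 = 2w≢0 ∘ trans (sym (double-+-cancel w (c - e) 2[c-e]≡0))
                         ∘ trans (cong double (sym ([x+y]-z≡y+[x-z] c w e)))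

    f-G∖ : ∀ {c : G n} (c≢0 : c ≢ 0G) → f (G∖ c c≢0) ≡ G∖ c c≢0
    f-G∖ {c} c≢0 with u , u∉ ← f-missing {G∖ c c≢0} {c} ∉-delete-self =
      P₀-ext (λ g∉ → subst (_∉ G∖ c c≢0) (sym (trans (f-G∖-unique {c≢0 = c≢0} g∉ u∉) u≡c)) ∉-delete-self)
             (λ g∉ → subst (_∉ f (G∖ c c≢0)) (trans u≡c (sym (∉-G∖⁻ g∉))) u∉)
      where
      u≡c : u ≡ c
      u≡c = f-G∖-missing {c≢0 = c≢0} u∉

    fixed-if-coset-wide : ∀ {X : P₀ n} {c a} → FixedBelow (missing X) → MissingInCoset X → c ∉ X → a ∉ X →
                          double (c - a) ≢ 0G → f X ≡ X
    fixed-if-coset-wide {X} {c} {a} fixed coset c∉X a∉X 2[c-a]≢0 =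
      fixed-by-deleting {z≢0 = p≢0} per-p p≢0 c∉X p∈X shifts-fixed
      where
      p = a - c
      per-p : Period X p
      per-p = coset a∉X c∉X
      c≢a : c ≢ a
      c≢a refl = 2[c-a]≢0 (trans (cong double (inverseʳ c)) double-0)
      p≢0 : p ≢ 0G
      p≢0 = c≢a ∘ sym ∘ x∙y⁻¹≈ε⇒x≈y a c
      p∈X : p ∈ X
      p∈X = ∈-stable {g = p} {X} λ p∉X → Period-∉⁺ (coset p∉X a∉X) c∉X
        (subst (_∈ X) (sym (trans (cong (c +G_) ([x-y]-x≡-y a c)) (inverseʳ c))) (0∈ X))
      a≢a+p : a ≢ a +G p
      a≢a+p = p≢0 ∘ x+y≡x⇒y≡0 ∘ sym
      c≢a+p : c ≢ a +G p
      c≢a+p c≡a+p = 2[c-a]≢0 (x≡-x⇒double≡0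
        (trans (cong (_- a) c≡a+p) (trans ([x+y]-x≡y a p) (sym (⁻¹-anti-homo‿- c a)))))
      3≤missing : 3 ≤ missing X
      3≤missing = length-≤-missing ((c≢a ∷ c≢a+p ∷ []) ∷ (a≢a+p ∷ []) ∷ [] ∷ [])
        λ { (here refl) → c∉X ; (there (here refl)) → a∉X ; (there (there (here refl))) → Period-∉⁺ per-p a∉X }
      shifts-fixed : ∀ {b} → ¬ Period X b → f (σ b (delete p p≢0 X)) ≡ σ b (delete p p≢0 X)
      shifts-fixed ¬per = fixed _ (≤-trans (s≤s (missing-≤-2 (∉-σ-delete⁻ coset ¬per))) 3≤missing)

    fixed-if-coset-narrow : ∀ {X : P₀ n} {c a} → FixedBelow (missing X) → MissingInCoset X → c ∉ X → a ∉ X → a ≢ c →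
                            (∀ {x} → x ∉ X → double (c - x) ≡ 0G) → f X ≡ X
    fixed-if-coset-narrow {X} {c} {a} fixed coset c∉X a∉X a≢c 2[c-x]≡0 with w , 2w≢0 , z≢0 ← avoid-0 {v = v} 2v≢0 c =
      fixed-by-deleting {z≢0 = z≢0} (coset a∉X c∉X) (a≢c ∘ x∙y⁻¹≈ε⇒x≈y a c) c∉X z∈X shifts-fixed
      where
      z = c +G w
      2[c-z]≢0 : double (c - z) ≢ 0G
      2[c-z]≢0 = subst (λ x → double x ≢ 0G) (sym (x-[x+y]≡-y c w)) (double-neg≢0 {x = w} 2w≢0)
      z∈X : z ∈ X
      z∈X = ∈-stable {g = z} {X} λ z∉X → 2[c-z]≢0 (2[c-x]≡0 z∉X)
      2≤missing : 2 ≤ missing X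
      2≤missing = length-≤-missing (((a≢c ∘ sym) ∷ []) ∷ [] ∷ []) λ { (here refl) → c∉X ; (there (here refl)) → a∉X }
      shifts-fixed : ∀ {b} → ¬ Period X b → f (σ b (delete z z≢0 X)) ≡ σ b (delete z z≢0 X)
      shifts-fixed {b} ¬per = cases (z ∈? X′) (z +G b ∈? X′)
        where
        X′ : P₀ n
        X′ = σ b (delete z z≢0 X)
        X′⊆z,z+b : ∀ {g} → g ∉ X′ → g ≡ z ⊎ g ≡ z +G b
        X′⊆z,z+b = ∉-σ-delete⁻ coset ¬per
        2b≢0 : z - b ∉ X → double b ≢ 0G
        2b≢0 z-b∉X 2b≡0 = 2[c-z]≢0 (trans (sym (double-+-cancel (c - z) b 2b≡0))
          (trans (cong double (sym (x-[y-z]≡[x-y]+z c z b))) (2[c-x]≡0 z-b∉X)))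
        cases : Dec (z ∈ X′) → Dec (z +G b ∈ X′) → f X′ ≡ X′
        cases (yes z∈X′) _       = fixed X′ (≤-trans (s≤s (missing-≤-1 X′⊆z,z+b z∈X′)) 2≤missing)
        cases (no _) (yes z+b∈X′) = fixed X′ (≤-trans (s≤s (missing-≤-1 (swap ∘ X′⊆z,z+b) z+b∈X′)) 2≤missing)
        cases (no z∉X′) (no z+b∉X′) = fixed-if-aperiodic
          (λ Y Y<X′ → fixed Y (<-≤-trans Y<X′ (≤-trans (missing-≤-2 X′⊆z,z+b) 2≤missing)))
          z+b∉X′ z∉X′ (σ-delete-aperiodic coset ¬per z∉X′ 2b≢0 ∘ subst (Period X′) ([x+y]-x≡y z b))

    fixed-if-MissingInCoset : ∀ {X : P₀ n} → FixedBelow (missing X) → MissingInCoset X → f X ≡ X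
    fixed-if-MissingInCoset {X} fixed coset with ∃?ᴳ (_∉? X)
    ... | no ¬gap = subst (λ Y → f Y ≡ Y) (sym X≡full) f-full
      where X≡full = full-unique λ g → ∈-stable {X = X} λ g∉X → ¬gap (g , g∉X)
    ... | yes (c , c∉X) with ∃?ᴳ (λ a → a ∉? X ×-dec ¬? (a ≟G c))
    ...   | no ¬other = subst (λ Y → f Y ≡ Y) (sym (G∖-unique c∉X only-c)) (f-G∖ (∉⇒≢0 X c∉X))
      where only-c = λ {g} g∉X → decidable-stable (g ≟G c) λ g≢c → ¬other (g , g∉X , g≢c)
    ...   | yes (a , a∉X , a≢c) with ∃?ᴳ (λ a → a ∉? X ×-dec ¬? (double (c - a) ≟G 0G))
    ...     | yes (a′ , a′∉X , 2[c-a′]≢0) = fixed-if-coset-wide fixed coset c∉X a′∉X 2[c-a′]≢0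
    ...     | no ¬wide = fixed-if-coset-narrow fixed coset c∉X a∉X a≢c
                           λ {x} x∉X → decidable-stable (double (c - x) ≟G 0G) λ ne → ¬wide (x , x∉X , ne)

    fixed-step : ∀ {X : P₀ n} → FixedBelow (missing X) → f X ≡ X
    fixed-step {X} fixed with ∃?ᴳ (λ x → ∃?ᴳ λ y → x ∉? X ×-dec y ∉? X ×-dec ¬? (period? X (x - y)))
    ... | yes (x , y , x∉X , y∉X , ¬per) = fixed-if-aperiodic fixed x∉X y∉X ¬per
    ... | no ¬aperiodic = fixed-if-MissingInCoset fixed λ {x} {y} x∉X y∉X →
      decidable-stable (period? X (x - y)) λ ¬per → ¬aperiodic (x , y , x∉X , y∉X , ¬per)

    fixed-below : ∀ k → FixedBelow k
    fixed-below (suc k) Y (s≤s missing≤k) = fixed-step λ Z Z<Y → fixed-below k Z (<-≤-trans Z<Y missing≤k)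

    all-fixed : ∀ X → f X ≡ X
    all-fixed X = fixed-below (suc (missing X)) X ≤-refl

order>2-element : ∀ {n} → 2 ≤ n → ∃ λ (v : G n) → double v ≢ 0G
order>2-element {n} 2≤n = (0F , one) , λ 2v≡0 → 0≢1+n (trans (sym (cong (toℕ ∘ proj₂) 2v≡0)) toℕ-one+one)
  where
  1<1+n = s≤s (≤-trans (s≤s z≤n) 2≤n)
  one = fromℕ< 1<1+n
  toℕ-one+one : toℕ (one +ₘ one) ≡ 2
  toℕ-one+one = begin
    toℕ (one +ₘ one)                 ≡⟨ toℕ-+ₘ one one ⟩
    (toℕ one + toℕ one) % suc n      ≡⟨ cong₂ (λ x y → (x + y) % suc n) (toℕ-fromℕ< 1<1+n) (toℕ-fromℕ< 1<1+n) ⟩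
    2 % suc n                        ≡⟨ m<n⇒m%n≡m (s≤s 2≤n) ⟩
    2                                ∎

trivialPullback⇒identity : ∀ {n} → 2 ≤ n → (f : P₀ n → P₀ n) → IsAutomorphism f → TrivialPullback f → ∀ X → f X ≡ X
trivialPullback⇒identity 2≤n f aut triv with v , 2v≢0 ← order>2-element 2≤n = all-fixed aut triv {v} 2v≢0

lemma3p6 : (p n : ℕ) → Prime p → suc n ≡ 2 * p →
           (f : P₀ n → P₀ n) → IsAutomorphism f → TrivialPullback f →
           ∀ X → f X ≡ X
lemma3p6 p n p-prime 1+n≡2p = trivialPullback⇒identity 2≤n
  where
  2≤n : 2 ≤ n
  2≤n = ≤-trans (n≤1+n 2) (≤-pred (subst (4 ≤_) (sym 1+n≡2p) (*-monoʳ-≤ 2 1<p)))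
    where 1<p = nonTrivial⇒n>1 p {{prime⇒nonTrivial p-prime}}
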